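{- Let $1\leq p\leq n$ and let $g_{n,p}$ be the number of maximal hypercubes of dimension $p$ in the Lucas cube $\Lambda_n$. Then \[g_{n,p}=\frac{n}{p}\binom{p}{n-2p}.\]
   Context: $Q_n$ is the $n$-dimensional hypercube: vertices are binary strings of length $n$, adjacent iff they differ in exactly one coordinate. A Lucas string of length $n$ is a binary string $b_1\dots b_n$ with $b_ib_{i+1}=0$ for $1\le i<n$ and $b_1b_n\neq1$. The Lucas cube $\Lambda_n$ ($n\ge1$) is the subgraph of $Q_n$ induced by the Lucas strings of length $n$. A hypercube of dimension $p$ in $\Lambda_n$ is an induced subgraph isomorphic to $Q_p$; it is maximal if it is not contained in any induced subgraph of $\Lambda_n$ isomorphic to $Q_{p+1}$. Binomial coefficients $\binom{a}{b}$ are $0$ when $b<0$ or $b>a$. -}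

module Defs where

open import Data.Bool using (Bool; true; false; T; _∧_; _xor_; not; if_then_else_)
open import Data.Nat using (ℕ; zero; suc; _+_; _*_; _∸_; _≤ᵇ_)
open import Data.Nat.Combinatorics using (_C_)
open import Data.Vec using (Vec; []; _∷_)
open import Data.Product using (_×_; _,_; ∃-syntax)
open import Data.Empty using (⊥)
open import Relation.Nullary using (¬_)
open import Relation.Binary.PropositionalEquality using (_≡_)
open import Function.Bundles using (_⇔_)

Word : ℕ → Set
Word n = Vec Bool n

dist : ∀ {n} → Word n → Word n → ℕ
dist [] [] = 0
dist (a ∷ u) (b ∷ v) = (if a xor b then 1 else 0) + dist u v

Adj : ∀ {n} → Word n → Word n → Set
Adj u v = dist u v ≡ 1

noConsec : ∀ {n} → Word n → Bool
noConsec [] = true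
noConsec (a ∷ []) = true
noConsec (a ∷ b ∷ v) = not (a ∧ b) ∧ noConsec (b ∷ v)

lastBit : ∀ {n} → Word (suc n) → Bool
lastBit (a ∷ []) = a
lastBit (a ∷ b ∷ v) = lastBit (b ∷ v)

isLucas : ∀ {n} → Word n → Bool
isLucas [] = true
isLucas (a ∷ v) = noConsec (a ∷ v) ∧ not (a ∧ lastBit (a ∷ v))

Lucas : ∀ {n} → Word n → Set
Lucas v = T (isLucas v)

-- Finite sets of vertices of Q_n, represented canonically as binary tries
-- (so that propositional equality is extensional equality of sets).
VSet : ℕ → Set
VSet zero = Bool
VSet (suc n) = VSet n × VSet n

_∈V_ : ∀ {n} → Word n → VSet n → Set
[] ∈V b = T b
(false ∷ v) ∈V (S₀ , S₁) = v ∈V S₀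
(true ∷ v) ∈V (S₀ , S₁) = v ∈V S₁

_⊆V_ : ∀ {n} → VSet n → VSet n → Set
S ⊆V T = ∀ v → v ∈V S → v ∈V T

record InducesQ (n p : ℕ) (S : VSet n) : Set where
  field
    φ      : Word p → Word n
    φ-into : ∀ x → φ x ∈V S
    φ-onto : ∀ v → v ∈V S → ∃[ x ] φ x ≡ v
    φ-inj  : ∀ x y → φ x ≡ φ y → x ≡ y
    φ-adj  : ∀ x y → Adj x y ⇔ Adj (φ x) (φ y)

HypercubeΛ : (n p : ℕ) → VSet n → Set
HypercubeΛ n p S = (∀ v → v ∈V S → Lucas v) × InducesQ n p S

MaxHypercubeΛ : (n p : ℕ) → VSet n → Set
MaxHypercubeΛ n p S =
  HypercubeΛ n p S × ¬ (∃[ T ] (HypercubeΛ n (suc p) T × S ⊆V T))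

-- binom p (n - 2p) with the convention that it is 0 when n - 2p < 0.
binomLucas : (n p : ℕ) → ℕ
binomLucas n p = if (p + p) ≤ᵇ n then p C (n ∸ (p + p)) else 0

-- An induced copy of Q_p in Q_n is a subcube: the words agreeing with some b outside a mask m of
-- weight p (the embedding sends the p directions of Q_p to p coordinates, because two neighbours of a
-- vertex of Q_n have only one further common neighbour). Lucas strings are closed downwards in the
-- bitwise order, and the largest word of the subcube is b with the mask bits set, so the subcube lies
-- in Λ_n iff that top word is a Lucas string. If the subcube is a maximal hypercube of Λ_n, every Lucas
-- string above the top equals m, since otherwise one more coordinate could join the mask; for the top
-- itself this gives b ≤ m. Hence the maximal p-dimensional hypercubes of Λ_n are the down-sets
-- {v | v ≤ t} of the maximal Lucas strings t of weight p.
--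
-- A maximal Lucas string starting with 1 is a concatenation of p blocks 10 and 100; there are
-- C(p, n-2p) of them, and C(p-1, n-2p-1) of them start with 100. Every other maximal string is either
-- the rotation by one place of a block word (it ends in 1) or the rotation by two places of a block
-- word starting with 100 (it ends in 10). So p g = p (2 C(p, n-2p) + C(p-1, n-2p-1)) = n C(p, n-2p),
-- the last step being the absorption identity k C(p, k) = p C(p-1, k-1) with k = n-2p.

module Submission where

open import Defs
open import Data.Bool using (true; false; T; _∧_; _xor_; not; if_then_else_)
import Data.Bool as Bool
open import Data.Bool.Properties
  using (T-∧; ∧-comm; ∧-assoc; ∧-identityʳ; ≤-trans; ≤-antisym; ≤-minimum; ≤-maximum;
         not-involutive; not-¬; not-distribʳ-xor; xor-same; xor-assoc; xor-identityʳ)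
  renaming (_≟_ to _≟ᵇ_)
open import Data.Empty using (⊥-elim)
open import Data.Fin using (Fin; zero; suc)
open import Data.Fin.Properties using (any?) renaming (_≟_ to _≟ᶠ_)
open import Data.List using (List; []; _∷_; [_]; _++_; map; length)
open import Data.List.Membership.Propositional using (_∈_)
open import Data.List.Membership.Propositional.Properties
  using (∈-map⁺; ∈-map⁻; ∈-++⁺ˡ; ∈-++⁺ʳ; ∈-++⁻)
open import Data.List.Properties using (length-++; length-map)
import Data.List.Relation.Unary.All as All
import Data.List.Relation.Unary.AllPairs as AllPairs
open import Data.List.Relation.Unary.Any using (here)
open import Data.List.Relation.Unary.Unique.Propositional using (Unique)
import Data.List.Relation.Unary.Unique.Propositional.Properties as Unique
open import Data.Nat using (ℕ; zero; suc; _+_; _*_; _≤_; _<_; _≤ᵇ_; s≤s; z≤n)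
open import Data.Nat.Combinatorics using (_C_; nC1≡n; k>n⇒nCk≡0; nCk+nC[k+1]≡[n+1]C[k+1])
open import Data.Nat.Properties
  using (suc-injective; 1+n≢n; +-suc; +-comm; +-identityʳ; *-zeroʳ; *-identityʳ; ≤-pred;
         ≤-reflexive; <⇒≤; <⇒≱; ≮⇒≥; _<?_; ≤ᵇ⇒≤; ≤⇒≤ᵇ; m≤m+n; m+n∸m≡n;
         m≤n⇒∃[o]m+o≡n)
open import Data.Nat.Tactic.RingSolver using (solve-∀)
open import Data.Product using (_×_; _,_; proj₁; proj₂; ∃-syntax)
open import Data.Sum using (_⊎_; inj₁; inj₂)
open import Data.Unit using (tt)
open import Data.Vec using ([]; _∷_; head; lookup; replicate; updateAt; zipWith; tabulate; _∷ʳ_; initLast)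
open import Data.Vec.Properties
  using (lookup∘updateAt; lookup∘updateAt′; updateAt-updateAt; updateAt-id-local; updateAt-commutes;
         lookup-replicate; lookup-zipWith; lookup∘tabulate; tabulate∘lookup; tabulate-cong;
         ∷-injectiveʳ; ∷ʳ-injective; ∷ʳ-injectiveʳ; ≡-dec)
open import Data.Vec.Relation.Binary.Pointwise.Inductive as Pointwise using (Pointwise; []; _∷_)
open import Function using (_∘_)
open import Function.Bundles using (_⇔_; mk⇔; Equivalence)
open import Relation.Binary.PropositionalEquality hiding ([_])
open import Relation.Nullary using (¬_; yes; no; contradiction)

zeros ones : ∀ {n} → Word n
zeros = replicate _ false
ones = replicate _ true

weight : ∀ {n} → Word n → ℕ
weight = dist zeros

flip : ∀ {n} → Fin n → Word n → Word n
flip i u = updateAt u i not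

flip-involutive : ∀ {n} (i : Fin n) u → flip i (flip i u) ≡ u
flip-involutive i u = trans (updateAt-updateAt i u) (updateAt-id-local i u (not-involutive _))

flip-comm : ∀ {n} (i j : Fin n) u → flip i (flip j u) ≡ flip j (flip i u)
flip-comm i j u with i ≟ᶠ j
... | yes refl = refl
... | no i≢j = updateAt-commutes i j i≢j u

flip-index-injective : ∀ {n} {i j : Fin n} u → flip i u ≡ flip j u → i ≡ j
flip-index-injective {i = i} {j} u eq with i ≟ᶠ j
... | yes i≡j = i≡j
... | no i≢j = contradiction (begin
  lookup u i          ≡⟨ lookup∘updateAt′ i j i≢j u ⟨
  lookup (flip j u) i ≡⟨ cong (λ w → lookup w i) eq ⟨
  lookup (flip i u) i ≡⟨ lookup∘updateAt i u ⟩
  not (lookup u i)    ∎) (not-¬ refl)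
  where open ≡-Reasoning

flip-induction : ∀ {n} (P : Word n → Set) → P zeros → (∀ a {x} → P x → P (flip a x)) →
                 ∀ x → P x
flip-induction P base step [] = base
flip-induction P base step (false ∷ x) = flip-induction (P ∘ (false ∷_)) base (λ a → step (suc a)) x
flip-induction P base step (true ∷ x) =
  step zero (flip-induction (P ∘ (false ∷_)) base (λ a → step (suc a)) x)

dist-self : ∀ {n} (u : Word n) → dist u u ≡ 0
dist-self [] = refl
dist-self (true ∷ u) = dist-self u
dist-self (false ∷ u) = dist-self u

dist-sym : ∀ {n} (u v : Word n) → dist u v ≡ dist v u
dist-sym [] [] = refl
dist-sym (true ∷ u) (true ∷ v) = dist-sym u v
dist-sym (true ∷ u) (false ∷ v) = cong suc (dist-sym u v)
dist-sym (false ∷ u) (true ∷ v) = cong suc (dist-sym u v)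
dist-sym (false ∷ u) (false ∷ v) = dist-sym u v

dist≡0⇒≡ : ∀ {n} (u v : Word n) → dist u v ≡ 0 → u ≡ v
dist≡0⇒≡ [] [] _ = refl
dist≡0⇒≡ (true ∷ u) (true ∷ v) eq = cong (true ∷_) (dist≡0⇒≡ u v eq)
dist≡0⇒≡ (false ∷ u) (false ∷ v) eq = cong (false ∷_) (dist≡0⇒≡ u v eq)

Adj⇒flip : ∀ {n} (u v : Word n) → Adj u v → ∃[ i ] v ≡ flip i u
Adj⇒flip [] [] ()
Adj⇒flip (true ∷ u) (true ∷ v) adj = let i , eq = Adj⇒flip u v adj in suc i , cong (true ∷_) eq
Adj⇒flip (false ∷ u) (false ∷ v) adj = let i , eq = Adj⇒flip u v adj in suc i , cong (false ∷_) eq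
Adj⇒flip (true ∷ u) (false ∷ v) adj = zero , cong (false ∷_) (sym (dist≡0⇒≡ u v (suc-injective adj)))
Adj⇒flip (false ∷ u) (true ∷ v) adj = zero , cong (true ∷_) (sym (dist≡0⇒≡ u v (suc-injective adj)))

dist-flip-agree : ∀ {n} (u v : Word n) i → lookup u i ≡ lookup v i →
                  dist u (flip i v) ≡ suc (dist u v)
dist-flip-agree (true ∷ u) (true ∷ v) zero _ = refl
dist-flip-agree (false ∷ u) (false ∷ v) zero _ = refl
dist-flip-agree (true ∷ u) (true ∷ v) (suc i) eq = dist-flip-agree u v i eq
dist-flip-agree (true ∷ u) (false ∷ v) (suc i) eq = cong suc (dist-flip-agree u v i eq)
dist-flip-agree (false ∷ u) (true ∷ v) (suc i) eq = cong suc (dist-flip-agree u v i eq)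
dist-flip-agree (false ∷ u) (false ∷ v) (suc i) eq = dist-flip-agree u v i eq

dist-flip-disagree : ∀ {n} (u v : Word n) i → lookup u i ≢ lookup v i →
                     suc (dist u (flip i v)) ≡ dist u v
dist-flip-disagree (true ∷ u) (true ∷ v) zero ne = contradiction refl ne
dist-flip-disagree (false ∷ u) (false ∷ v) zero ne = contradiction refl ne
dist-flip-disagree (true ∷ u) (false ∷ v) zero _ = refl
dist-flip-disagree (false ∷ u) (true ∷ v) zero _ = refl
dist-flip-disagree (true ∷ u) (true ∷ v) (suc i) ne = dist-flip-disagree u v i ne
dist-flip-disagree (true ∷ u) (false ∷ v) (suc i) ne = cong suc (dist-flip-disagree u v i ne)
dist-flip-disagree (false ∷ u) (true ∷ v) (suc i) ne = cong suc (dist-flip-disagree u v i ne)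
dist-flip-disagree (false ∷ u) (false ∷ v) (suc i) ne = dist-flip-disagree u v i ne

Adj-flip : ∀ {n} (u : Word n) i → Adj u (flip i u)
Adj-flip u i = trans (dist-flip-agree u u i refl) (cong suc (dist-self u))

common-neighbour : ∀ {n} {i j : Fin n} (u w : Word n) → i ≢ j →
  Adj (flip i u) w → Adj (flip j u) w → w ≢ u → w ≡ flip j (flip i u)
common-neighbour {i = i} {j} u w i≢j adjᵢ adjⱼ w≢u with Adj⇒flip (flip i u) w adjᵢ
... | k , refl with k ≟ᶠ i | k ≟ᶠ j
...   | yes refl | _ = contradiction (flip-involutive i u) w≢u
...   | no _ | yes refl = refl
...   | no k≢i | no k≢j = contradiction (trans (sym distance-three) adjⱼ) λ ()
  where
    open ≡-Reasoning
    distance-three : dist (flip j u) (flip k (flip i u)) ≡ 3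
    distance-three = begin
      dist (flip j u) (flip k (flip i u))
        ≡⟨ dist-flip-agree (flip j u) (flip i u) k
             (trans (lookup∘updateAt′ k j k≢j u) (sym (lookup∘updateAt′ k i k≢i u))) ⟩
      suc (dist (flip j u) (flip i u))
        ≡⟨ cong suc (dist-flip-agree (flip j u) u i (lookup∘updateAt′ i j i≢j u)) ⟩
      suc (suc (dist (flip j u) u))
        ≡⟨ cong (λ d → suc (suc d)) (trans (dist-sym (flip j u) u) (Adj-flip u j)) ⟩
      3 ∎

dist-xor : ∀ {n} (u v : Word n) → dist u v ≡ weight (zipWith _xor_ u v)
dist-xor [] [] = refl
dist-xor (true ∷ u) (true ∷ v) = dist-xor u v
dist-xor (true ∷ u) (false ∷ v) = cong suc (dist-xor u v)
dist-xor (false ∷ u) (true ∷ v) = cong suc (dist-xor u v)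
dist-xor (false ∷ u) (false ∷ v) = dist-xor u v

weight-ones : ∀ n → weight (ones {n}) ≡ n
weight-ones zero = refl
weight-ones (suc n) = cong suc (weight-ones n)

xor-cancelˡ : ∀ x y → x xor (x xor y) ≡ y
xor-cancelˡ x y = trans (sym (xor-assoc x x y)) (cong (_xor y) (xor-same x))

xor-true : ∀ x → x xor true ≡ not x
xor-true x = trans (sym (not-distribʳ-xor x false)) (cong not (xor-identityʳ x))

lookup-extensionality : ∀ {n} {u v : Word n} → (∀ i → lookup u i ≡ lookup v i) → u ≡ v
lookup-extensionality {u = u} {v} eq =
  trans (sym (tabulate∘lookup u)) (trans (tabulate-cong eq) (tabulate∘lookup v))

infix 4 _≼_

_≼_ : ∀ {n} → Word n → Word n → Set
_≼_ = Pointwise Bool._≤_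

≼-refl : ∀ {n} {v : Word n} → v ≼ v
≼-refl = Pointwise.refl Bool.b≤b

≼-trans : ∀ {n} {u v w : Word n} → u ≼ v → v ≼ w → u ≼ w
≼-trans = Pointwise.trans ≤-trans

≼-antisym : ∀ {n} {u v : Word n} → u ≼ v → v ≼ u → u ≡ v
≼-antisym [] [] = refl
≼-antisym (a≤b ∷ u≼v) (b≤a ∷ v≼u) = cong₂ _∷_ (≤-antisym a≤b b≤a) (≼-antisym u≼v v≼u)

zeros-≼ : ∀ {n} (v : Word n) → zeros ≼ v
zeros-≼ [] = []
zeros-≼ (a ∷ v) = ≤-minimum a ∷ zeros-≼ v

∷ʳ⁺ : ∀ {n} {u v : Word n} {a b} → u ≼ v → a Bool.≤ b → u ∷ʳ a ≼ v ∷ʳ b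
∷ʳ⁺ [] a≤b = a≤b ∷ []
∷ʳ⁺ (x≤y ∷ u≼v) a≤b = x≤y ∷ ∷ʳ⁺ u≼v a≤b

∷ʳ⁻ : ∀ {n} (u v : Word n) {a b} → u ∷ʳ a ≼ v ∷ʳ b → u ≼ v × a Bool.≤ b
∷ʳ⁻ [] [] (a≤b ∷ []) = [] , a≤b
∷ʳ⁻ (x ∷ u) (y ∷ v) (x≤y ∷ le) = let u≼v , a≤b = ∷ʳ⁻ u v le in x≤y ∷ u≼v , a≤b

≺-step : ∀ {n} {m t : Word n} → m ≼ t → m ≢ t →
         ∃[ m′ ] (m ≼ m′ × m′ ≼ t × weight m′ ≡ suc (weight m))
≺-step [] m≢t = contradiction refl m≢t
≺-step {m = false ∷ m} (Bool.f≤t ∷ m≼t) _ =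
  true ∷ m , Bool.f≤t ∷ ≼-refl , Bool.b≤b ∷ m≼t , refl
≺-step {m = a ∷ m} (Bool.b≤b ∷ m≼t) a∷m≢a∷t with ≺-step m≼t (a∷m≢a∷t ∘ cong (a ∷_))
... | m′ , m≼m′ , m′≼t , eq =
  a ∷ m′ , Bool.b≤b ∷ m≼m′ , Bool.b≤b ∷ m′≼t , weight-∷ a m′ m eq
  where
    weight-∷ : ∀ a {n} (u v : Word n) → weight u ≡ suc (weight v) →
               weight (a ∷ u) ≡ suc (weight (a ∷ v))
    weight-∷ true _ _ eq = cong suc eq
    weight-∷ false _ _ eq = eq

data InSubcube : ∀ {n} → Word n → Word n → Word n → Set where
  [] : InSubcube [] [] []
  free : ∀ {n a x} {b m v : Word n} → InSubcube b m v → InSubcube (a ∷ b) (true ∷ m) (x ∷ v)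
  fixed : ∀ {n a} {b m v : Word n} → InSubcube b m v → InSubcube (a ∷ b) (false ∷ m) (a ∷ v)

InSubcube-lookup⁺ : ∀ {n} (b m v : Word n) → (∀ i → lookup m i ≡ false → lookup v i ≡ lookup b i) →
                    InSubcube b m v
InSubcube-lookup⁺ [] [] [] _ = []
InSubcube-lookup⁺ (a ∷ b) (true ∷ m) (x ∷ v) agree = free (InSubcube-lookup⁺ b m v (agree ∘ suc))
InSubcube-lookup⁺ (a ∷ b) (false ∷ m) (x ∷ v) agree with agree zero refl
... | refl = fixed (InSubcube-lookup⁺ b m v (agree ∘ suc))

InSubcube-lookup⁻ : ∀ {n} {b m v : Word n} → InSubcube b m v →
                    ∀ i → lookup m i ≡ false → lookup v i ≡ lookup b i
InSubcube-lookup⁻ (free s) (suc i) = InSubcube-lookup⁻ s i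
InSubcube-lookup⁻ (fixed s) zero _ = refl
InSubcube-lookup⁻ (fixed s) (suc i) = InSubcube-lookup⁻ s i

InSubcube-sym : ∀ {n} {b m v : Word n} → InSubcube b m v → InSubcube v m b
InSubcube-sym [] = []
InSubcube-sym (free s) = free (InSubcube-sym s)
InSubcube-sym (fixed s) = fixed (InSubcube-sym s)

InSubcube-trans : ∀ {n} {b m v w : Word n} → InSubcube b m v → InSubcube v m w → InSubcube b m w
InSubcube-trans [] [] = []
InSubcube-trans (free s) (free s′) = free (InSubcube-trans s s′)
InSubcube-trans (fixed s) (fixed s′) = fixed (InSubcube-trans s s′)

InSubcube-widen : ∀ {n} {b m m′ v : Word n} → m ≼ m′ → InSubcube b m v → InSubcube b m′ v
InSubcube-widen [] [] = []
InSubcube-widen (Bool.b≤b ∷ m≼m′) (free s) = free (InSubcube-widen m≼m′ s)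
InSubcube-widen (Bool.b≤b ∷ m≼m′) (fixed s) = fixed (InSubcube-widen m≼m′ s)
InSubcube-widen (Bool.f≤t ∷ m≼m′) (fixed s) = free (InSubcube-widen m≼m′ s)

InSubcube-zeros⁺ : ∀ {n} {m v : Word n} → v ≼ m → InSubcube zeros m v
InSubcube-zeros⁺ [] = []
InSubcube-zeros⁺ (Bool.f≤t ∷ v≼m) = free (InSubcube-zeros⁺ v≼m)
InSubcube-zeros⁺ (Bool.b≤b {true} ∷ v≼m) = free (InSubcube-zeros⁺ v≼m)
InSubcube-zeros⁺ (Bool.b≤b {false} ∷ v≼m) = fixed (InSubcube-zeros⁺ v≼m)

InSubcube-zeros⁻ : ∀ {n} {m v : Word n} → InSubcube zeros m v → v ≼ m
InSubcube-zeros⁻ [] = []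
InSubcube-zeros⁻ {v = x ∷ v} (free s) = ≤-maximum x ∷ InSubcube-zeros⁻ s
InSubcube-zeros⁻ (fixed s) = Bool.b≤b ∷ InSubcube-zeros⁻ s

top : ∀ {n} → Word n → Word n → Word n
top [] [] = []
top (a ∷ b) (true ∷ m) = true ∷ top b m
top (a ∷ b) (false ∷ m) = a ∷ top b m

InSubcube-top : ∀ {n} (b m : Word n) → InSubcube b m (top b m)
InSubcube-top [] [] = []
InSubcube-top (a ∷ b) (true ∷ m) = free (InSubcube-top b m)
InSubcube-top (a ∷ b) (false ∷ m) = fixed (InSubcube-top b m)

InSubcube⇒≼top : ∀ {n} {b m v : Word n} → InSubcube b m v → v ≼ top b m
InSubcube⇒≼top [] = []
InSubcube⇒≼top {v = x ∷ v} (free s) = ≤-maximum x ∷ InSubcube⇒≼top s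
InSubcube⇒≼top (fixed s) = Bool.b≤b ∷ InSubcube⇒≼top s

top-least : ∀ {n} {b m t : Word n} → b ≼ t → m ≼ t → top b m ≼ t
top-least [] [] = []
top-least (_ ∷ b≼t) (Bool.b≤b {true} ∷ m≼t) = Bool.b≤b ∷ top-least b≼t m≼t
top-least (a≤c ∷ b≼t) (Bool.b≤b {false} ∷ m≼t) = a≤c ∷ top-least b≼t m≼t
top-least (a≤c ∷ b≼t) (Bool.f≤t ∷ m≼t) = a≤c ∷ top-least b≼t m≼t

≼top : ∀ {n} (b m : Word n) → b ≼ top b m × m ≼ top b m
≼top [] [] = [] , []
≼top (a ∷ b) (true ∷ m) = ≤-maximum a ∷ proj₁ (≼top b m) , Bool.b≤b ∷ proj₂ (≼top b m)
≼top (a ∷ b) (false ∷ m) = Bool.b≤b ∷ proj₁ (≼top b m) , ≤-minimum a ∷ proj₂ (≼top b m)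

fill : ∀ {n} (b m : Word n) → Word (weight m) → Word n
fill [] [] [] = []
fill (a ∷ b) (true ∷ m) (x ∷ xs) = x ∷ fill b m xs
fill (a ∷ b) (false ∷ m) xs = a ∷ fill b m xs

dist-fill : ∀ {n} (b m : Word n) x y → dist (fill b m x) (fill b m y) ≡ dist x y
dist-fill [] [] [] [] = refl
dist-fill (a ∷ b) (true ∷ m) (x ∷ xs) (y ∷ ys) =
  cong ((if x xor y then 1 else 0) +_) (dist-fill b m xs ys)
dist-fill (true ∷ b) (false ∷ m) xs ys = dist-fill b m xs ys
dist-fill (false ∷ b) (false ∷ m) xs ys = dist-fill b m xs ys

InSubcube-fill : ∀ {n} (b m : Word n) x → InSubcube b m (fill b m x)
InSubcube-fill [] [] [] = []
InSubcube-fill (a ∷ b) (true ∷ m) (x ∷ xs) = free (InSubcube-fill b m xs)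
InSubcube-fill (a ∷ b) (false ∷ m) xs = fixed (InSubcube-fill b m xs)

InSubcube⇒fill : ∀ {n} {b m v : Word n} → InSubcube b m v → ∃[ x ] fill b m x ≡ v
InSubcube⇒fill [] = [] , refl
InSubcube⇒fill {v = y ∷ _} (free s) with InSubcube⇒fill s
... | x , refl = y ∷ x , refl
InSubcube⇒fill (fixed s) with InSubcube⇒fill s
... | x , refl = x , refl

∅ : ∀ {n} → VSet n
∅ {zero} = false
∅ {suc n} = ∅ , ∅

∉∅ : ∀ {n} (v : Word n) → ¬ v ∈V ∅
∉∅ [] ()
∉∅ (false ∷ v) = ∉∅ v
∉∅ (true ∷ v) = ∉∅ v

subcube : ∀ {n} → Word n → Word n → VSet n
subcube [] [] = true
subcube (a ∷ b) (true ∷ m) = subcube b m , subcube b m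
subcube (false ∷ b) (false ∷ m) = subcube b m , ∅
subcube (true ∷ b) (false ∷ m) = ∅ , subcube b m

∈-subcube⁺ : ∀ {n} {b m v : Word n} → InSubcube b m v → v ∈V subcube b m
∈-subcube⁺ [] = tt
∈-subcube⁺ {v = false ∷ _} (free s) = ∈-subcube⁺ s
∈-subcube⁺ {v = true ∷ _} (free s) = ∈-subcube⁺ s
∈-subcube⁺ {b = false ∷ _} (fixed s) = ∈-subcube⁺ s
∈-subcube⁺ {b = true ∷ _} (fixed s) = ∈-subcube⁺ s

∈-subcube⁻ : ∀ {n} (b m v : Word n) → v ∈V subcube b m → InSubcube b m v
∈-subcube⁻ [] [] [] _ = []
∈-subcube⁻ (a ∷ b) (true ∷ m) (false ∷ v) v∈ = free (∈-subcube⁻ b m v v∈)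
∈-subcube⁻ (a ∷ b) (true ∷ m) (true ∷ v) v∈ = free (∈-subcube⁻ b m v v∈)
∈-subcube⁻ (false ∷ b) (false ∷ m) (false ∷ v) v∈ = fixed (∈-subcube⁻ b m v v∈)
∈-subcube⁻ (false ∷ b) (false ∷ m) (true ∷ v) v∈ = contradiction v∈ (∉∅ v)
∈-subcube⁻ (true ∷ b) (false ∷ m) (false ∷ v) v∈ = contradiction v∈ (∉∅ v)
∈-subcube⁻ (true ∷ b) (false ∷ m) (true ∷ v) v∈ = fixed (∈-subcube⁻ b m v v∈)

VSet-ext : ∀ {n} (S T : VSet n) → S ⊆V T → T ⊆V S → S ≡ T
VSet-ext {zero} false false _ _ = refl
VSet-ext {zero} true true _ _ = refl
VSet-ext {zero} true false S⊆T _ = ⊥-elim (S⊆T [] tt)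
VSet-ext {zero} false true _ T⊆S = ⊥-elim (T⊆S [] tt)
VSet-ext {suc n} (S₀ , S₁) (T₀ , T₁) S⊆T T⊆S =
  cong₂ _,_ (VSet-ext S₀ T₀ (S⊆T ∘ (false ∷_)) (T⊆S ∘ (false ∷_)))
            (VSet-ext S₁ T₁ (S⊆T ∘ (true ∷_)) (T⊆S ∘ (true ∷_)))

subcube-induces : ∀ {n} (b m : Word n) → InducesQ n (weight m) (subcube b m)
subcube-induces b m = record
  { φ = fill b m
  ; φ-into = λ x → ∈-subcube⁺ (InSubcube-fill b m x)
  ; φ-onto = λ v v∈ → InSubcube⇒fill (∈-subcube⁻ b m v v∈)
  ; φ-inj = λ x y eq →
      dist≡0⇒≡ x y (trans (sym (dist-fill b m x y))
                         (trans (cong (dist (fill b m x)) (sym eq)) (dist-self (fill b m x))))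
  ; φ-adj = λ x y → mk⇔ (trans (dist-fill b m x y)) (trans (sym (dist-fill b m x y)))
  }

-- Induced hypercubes of Q_n are subcubes

module Embedding {n p : ℕ} {S : VSet n} (iq : InducesQ n p S) where
  open InducesQ iq
  open ≡-Reasoning

  φ₀ : Word n
  φ₀ = φ zeros

  φ-Adj-flip : ∀ x a → Adj (φ x) (φ (flip a x))
  φ-Adj-flip x a = Equivalence.to (φ-adj x (flip a x)) (Adj-flip x a)

  direction : Fin p → Fin n
  direction a = proj₁ (Adj⇒flip φ₀ (φ (flip a zeros)) (φ-Adj-flip zeros a))

  Commutes : Word p → Set
  Commutes x = ∀ a → φ (flip a x) ≡ flip (direction a) (φ x)

  commutes-zeros : Commutes zeros
  commutes-zeros a = proj₂ (Adj⇒flip φ₀ (φ (flip a zeros)) (φ-Adj-flip zeros a))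

  direction-injective : ∀ {a b} → direction a ≡ direction b → a ≡ b
  direction-injective {a} {b} eq = flip-index-injective zeros (φ-inj _ _ (begin
    φ (flip a zeros)       ≡⟨ commutes-zeros a ⟩
    flip (direction a) φ₀  ≡⟨ cong (λ i → flip i φ₀) eq ⟩
    flip (direction b) φ₀  ≡⟨ commutes-zeros b ⟨
    φ (flip b zeros)       ∎))

  -- φ (flip a (flip b x)) ≠ φ x is a common neighbour of φ (flip a x) and φ (flip b x).
  commutes-flip : ∀ b {x} → Commutes x → Commutes (flip b x)
  commutes-flip b {x} comm a with a ≟ᶠ b
  ... | yes refl = begin
    φ (flip a (flip a x))                         ≡⟨ cong φ (flip-involutive a x) ⟩
    φ x                                           ≡⟨ flip-involutive (direction a) (φ x) ⟨
    flip (direction a) (flip (direction a) (φ x)) ≡⟨ cong (flip (direction a)) (comm a) ⟨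
    flip (direction a) (φ (flip a x))             ∎
  ... | no a≢b = trans
    (common-neighbour (φ x) w (a≢b ∘ sym ∘ direction-injective) adj-b adj-a w≢φx)
    (cong (flip (direction a)) (sym (comm b)))
    where
      w : Word n
      w = φ (flip a (flip b x))
      adj-b : Adj (flip (direction b) (φ x)) w
      adj-b = subst (λ z → Adj z w) (comm b) (φ-Adj-flip (flip b x) a)
      adj-a : Adj (flip (direction a) (φ x)) w
      adj-a = subst (λ z → Adj z w) (comm a)
                (subst (Adj (φ (flip a x))) (cong φ (flip-comm b a x)) (φ-Adj-flip (flip a x) b))
      w≢φx : w ≢ φ x
      w≢φx eq = a≢b (sym (flip-index-injective x (begin
        flip b x                   ≡⟨ flip-involutive a (flip b x) ⟨
        flip a (flip a (flip b x)) ≡⟨ cong (flip a) (φ-inj _ _ eq) ⟩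
        flip a x                   ∎)))

  commutes : ∀ x → Commutes x
  commutes = flip-induction Commutes commutes-zeros commutes-flip

  lookup-φ-direction : ∀ x a → lookup (φ x) (direction a) ≡ lookup φ₀ (direction a) xor lookup x a
  lookup-φ-direction = flip-induction _ base step
    where
      base : ∀ a → lookup φ₀ (direction a) ≡ lookup φ₀ (direction a) xor lookup zeros a
      base a = sym (trans (cong (lookup φ₀ (direction a) xor_) (lookup-replicate a false)) (xor-identityʳ _))
      step : ∀ b {x} → (∀ a → lookup (φ x) (direction a) ≡ lookup φ₀ (direction a) xor lookup x a) →
             ∀ a → lookup (φ (flip b x)) (direction a) ≡ lookup φ₀ (direction a) xor lookup (flip b x) a
      step b {x} ih a with a ≟ᶠ b
      ... | yes refl = begin
        lookup (φ (flip a x)) (direction a)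
          ≡⟨ cong (λ w → lookup w (direction a)) (commutes x a) ⟩
        lookup (flip (direction a) (φ x)) (direction a)
          ≡⟨ lookup∘updateAt (direction a) (φ x) ⟩
        not (lookup (φ x) (direction a))
          ≡⟨ cong not (ih a) ⟩
        not (lookup φ₀ (direction a) xor lookup x a)
          ≡⟨ not-distribʳ-xor (lookup φ₀ (direction a)) (lookup x a) ⟩
        lookup φ₀ (direction a) xor not (lookup x a)
          ≡⟨ cong (lookup φ₀ (direction a) xor_) (lookup∘updateAt a x) ⟨
        lookup φ₀ (direction a) xor lookup (flip a x) a ∎
      ... | no a≢b = begin
        lookup (φ (flip b x)) (direction a)
          ≡⟨ cong (λ w → lookup w (direction a)) (commutes x b) ⟩
        lookup (flip (direction b) (φ x)) (direction a)
          ≡⟨ lookup∘updateAt′ _ _ (a≢b ∘ direction-injective) (φ x) ⟩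
        lookup (φ x) (direction a)
          ≡⟨ ih a ⟩
        lookup φ₀ (direction a) xor lookup x a
          ≡⟨ cong (lookup φ₀ (direction a) xor_) (lookup∘updateAt′ a b a≢b x) ⟨
        lookup φ₀ (direction a) xor lookup (flip b x) a ∎

  lookup-φ-outside : ∀ {i} → (∀ a → direction a ≢ i) → ∀ x → lookup (φ x) i ≡ lookup φ₀ i
  lookup-φ-outside {i} outside = flip-induction _ refl λ b {x} ih →
    trans (cong (λ w → lookup w i) (commutes x b))
          (trans (lookup∘updateAt′ i (direction b) (outside b ∘ sym) (φ x)) ih)

  dist-φ₀ : ∀ x → dist φ₀ (φ x) ≡ weight x
  dist-φ₀ = flip-induction _ (trans (dist-self φ₀) (sym (dist-self (zeros {p})))) step
    where
      step : ∀ b {x} → dist φ₀ (φ x) ≡ weight x → dist φ₀ (φ (flip b x)) ≡ weight (flip b x)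
      step b {x} ih with lookup x b in xᵦ | lookup-φ-direction x b
      ... | false | φxᵦ = begin
        dist φ₀ (φ (flip b x))             ≡⟨ cong (dist φ₀) (commutes x b) ⟩
        dist φ₀ (flip (direction b) (φ x)) ≡⟨ dist-flip-agree φ₀ (φ x) _ φ-agrees ⟩
        suc (dist φ₀ (φ x))                ≡⟨ cong suc ih ⟩
        suc (weight x)                     ≡⟨ dist-flip-agree zeros x b zeros-agrees ⟨
        weight (flip b x)                  ∎
        where
          φ-agrees : lookup φ₀ (direction b) ≡ lookup (φ x) (direction b)
          φ-agrees = sym (trans φxᵦ (xor-identityʳ _))
          zeros-agrees : lookup zeros b ≡ lookup x b
          zeros-agrees = trans (lookup-replicate b false) (sym xᵦ)
      ... | true | φxᵦ = suc-injective (begin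
        suc (dist φ₀ (φ (flip b x)))             ≡⟨ cong (suc ∘ dist φ₀) (commutes x b) ⟩
        suc (dist φ₀ (flip (direction b) (φ x))) ≡⟨ dist-flip-disagree φ₀ (φ x) _ φ-disagrees ⟩
        dist φ₀ (φ x)                            ≡⟨ ih ⟩
        weight x                                 ≡⟨ dist-flip-disagree zeros x b zeros-disagrees ⟨
        suc (weight (flip b x))                  ∎)
        where
          φ-disagrees : lookup φ₀ (direction b) ≢ lookup (φ x) (direction b)
          φ-disagrees eq = not-¬ refl (trans eq (trans φxᵦ (xor-true _)))
          zeros-disagrees : lookup zeros b ≢ lookup x b
          zeros-disagrees eq = contradiction (trans (sym (lookup-replicate b false)) (trans eq xᵦ)) λ ()

  mask : Word n
  mask = zipWith _xor_ φ₀ (φ ones)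

  weight-mask : weight mask ≡ p
  weight-mask = trans (sym (dist-xor φ₀ (φ ones))) (trans (dist-φ₀ ones) (weight-ones p))

  lookup-mask-direction : ∀ a → lookup mask (direction a) ≡ true
  lookup-mask-direction a = begin
    lookup mask (direction a)
      ≡⟨ lookup-zipWith _xor_ (direction a) φ₀ (φ ones) ⟩
    lookup φ₀ (direction a) xor lookup (φ ones) (direction a)
      ≡⟨ cong (lookup φ₀ (direction a) xor_) (lookup-φ-direction ones a) ⟩
    lookup φ₀ (direction a) xor (lookup φ₀ (direction a) xor lookup ones a)
      ≡⟨ xor-cancelˡ (lookup φ₀ (direction a)) (lookup ones a) ⟩
    lookup ones a
      ≡⟨ lookup-replicate a true ⟩
    true ∎

  lookup-mask-outside : ∀ {i} → (∀ a → direction a ≢ i) → lookup mask i ≡ false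
  lookup-mask-outside {i} outside = begin
    lookup mask i                     ≡⟨ lookup-zipWith _xor_ i φ₀ (φ ones) ⟩
    lookup φ₀ i xor lookup (φ ones) i ≡⟨ cong (lookup φ₀ i xor_) (lookup-φ-outside outside ones) ⟩
    lookup φ₀ i xor lookup φ₀ i       ≡⟨ xor-same (lookup φ₀ i) ⟩
    false                             ∎

  φ-InSubcube : ∀ x → InSubcube φ₀ mask (φ x)
  φ-InSubcube x = InSubcube-lookup⁺ φ₀ mask (φ x) agree
    where
      agree : ∀ i → lookup mask i ≡ false → lookup (φ x) i ≡ lookup φ₀ i
      agree i maskᵢ with any? (λ a → direction a ≟ᶠ i)
      ... | yes (a , refl) = contradiction (trans (sym maskᵢ) (lookup-mask-direction a)) λ ()
      ... | no outside = lookup-φ-outside (λ a eq → outside (a , eq)) x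

  InSubcube⇒φ : ∀ {v} → InSubcube φ₀ mask v → ∃[ x ] φ x ≡ v
  InSubcube⇒φ {v} v∈ = x , lookup-extensionality agree
    where
      x : Word p
      x = tabulate (λ a → lookup φ₀ (direction a) xor lookup v (direction a))
      agree : ∀ i → lookup (φ x) i ≡ lookup v i
      agree i with any? (λ a → direction a ≟ᶠ i)
      ... | yes (a , refl) = begin
        lookup (φ x) (direction a)
          ≡⟨ lookup-φ-direction x a ⟩
        lookup φ₀ (direction a) xor lookup x a
          ≡⟨ cong (lookup φ₀ (direction a) xor_) (lookup∘tabulate _ a) ⟩
        lookup φ₀ (direction a) xor (lookup φ₀ (direction a) xor lookup v (direction a))
          ≡⟨ xor-cancelˡ (lookup φ₀ (direction a)) (lookup v (direction a)) ⟩
        lookup v (direction a) ∎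
      ... | no outside = trans (lookup-φ-outside outside′ x)
                               (sym (InSubcube-lookup⁻ v∈ i (lookup-mask-outside outside′)))
        where
          outside′ : ∀ a → direction a ≢ i
          outside′ a eq = outside (a , eq)

induced-subcube : ∀ {n p} {S : VSet n} → InducesQ n p S →
  ∃[ b ] ∃[ m ] (weight m ≡ p × (∀ v → v ∈V S ⇔ InSubcube b m v))
induced-subcube {S = S} iq = φ₀ , mask , weight-mask , λ v → mk⇔ (to v) (from v)
  where
    open InducesQ iq
    open Embedding iq
    to : ∀ v → v ∈V S → InSubcube φ₀ mask v
    to v v∈S with φ-onto v v∈S
    ... | x , refl = φ-InSubcube x
    from : ∀ v → InSubcube φ₀ mask v → v ∈V S
    from v v∈ with InSubcube⇒φ v∈
    ... | x , refl = φ-into x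

noConsec-tail : ∀ {n} a (v : Word n) → T (noConsec (a ∷ v)) → T (noConsec v)
noConsec-tail a [] _ = tt
noConsec-tail a (b ∷ v) nc = proj₂ (Equivalence.to T-∧ nc)

noConsec-false∷ : ∀ {n} (v : Word n) → T (noConsec v) → T (noConsec (false ∷ v))
noConsec-false∷ [] _ = tt
noConsec-false∷ (b ∷ v) nc = nc

noConsec-antitone : ∀ {n} {v t : Word n} → v ≼ t → T (noConsec t) → T (noConsec v)
noConsec-antitone [] _ = tt
noConsec-antitone (_ ∷ []) _ = tt
noConsec-antitone {v = false ∷ v} {_ ∷ t} (_ ∷ v≼t) nc =
  noConsec-false∷ v (noConsec-antitone v≼t (noConsec-tail _ t nc))
noConsec-antitone {v = true ∷ false ∷ v} {true ∷ t} (_ ∷ v≼t) nc =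
  noConsec-antitone v≼t (noConsec-tail true t nc)
noConsec-antitone {v = true ∷ true ∷ v} {true ∷ true ∷ t} (_ ∷ _ ∷ _) ()

lastBit-∷ʳ : ∀ {n} (w : Word n) a → lastBit (w ∷ʳ a) ≡ a
lastBit-∷ʳ [] a = refl
lastBit-∷ʳ (x ∷ []) a = refl
lastBit-∷ʳ (x ∷ y ∷ w) a = lastBit-∷ʳ (y ∷ w) a

noConsec-∷ʳ : ∀ {n} x (w : Word n) a →
              noConsec ((x ∷ w) ∷ʳ a) ≡ noConsec (x ∷ w) ∧ not (lastBit (x ∷ w) ∧ a)
noConsec-∷ʳ x [] a = ∧-identityʳ (not (x ∧ a))
noConsec-∷ʳ x (y ∷ w) a =
  trans (cong (not (x ∧ y) ∧_) (noConsec-∷ʳ y w a)) (sym (∧-assoc (not (x ∧ y)) _ _))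

isLucas-cyclic : ∀ {n} a (v : Word n) → isLucas (a ∷ v) ≡ noConsec ((a ∷ v) ∷ʳ a)
isLucas-cyclic a v =
  trans (cong (λ z → noConsec (a ∷ v) ∧ not z) (∧-comm a (lastBit (a ∷ v)))) (sym (noConsec-∷ʳ a v a))

Lucas-antitone : ∀ {n} {v t : Word n} → v ≼ t → Lucas t → Lucas v
Lucas-antitone [] _ = tt
Lucas-antitone {v = a ∷ v} {b ∷ t} (a≤b ∷ v≼t) Lt =
  subst T (sym (isLucas-cyclic a v))
    (noConsec-antitone (∷ʳ⁺ (a≤b ∷ v≼t) a≤b) (subst T (isLucas-cyclic b t) Lt))

rotate : ∀ {n} → Word (suc n) → Word (suc n)
rotate (a ∷ v) = v ∷ʳ a

isLucas-rotate : ∀ {n} (t : Word (suc n)) → isLucas (rotate t) ≡ isLucas t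
isLucas-rotate (a ∷ []) = refl
isLucas-rotate (a ∷ b ∷ v) = begin
  isLucas (b ∷ (v ∷ʳ a))
    ≡⟨ isLucas-cyclic b (v ∷ʳ a) ⟩
  noConsec ((b ∷ (v ∷ʳ a)) ∷ʳ b)
    ≡⟨ noConsec-∷ʳ b (v ∷ʳ a) b ⟩
  noConsec (b ∷ (v ∷ʳ a)) ∧ not (lastBit (b ∷ (v ∷ʳ a)) ∧ b)
    ≡⟨ cong (λ z → noConsec (b ∷ (v ∷ʳ a)) ∧ not (z ∧ b)) (lastBit-∷ʳ (b ∷ v) a) ⟩
  noConsec (b ∷ (v ∷ʳ a)) ∧ not (a ∧ b)
    ≡⟨ ∧-comm (noConsec (b ∷ (v ∷ʳ a))) _ ⟩
  noConsec ((a ∷ b ∷ v) ∷ʳ a)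
    ≡⟨ isLucas-cyclic a (b ∷ v) ⟨
  isLucas (a ∷ b ∷ v) ∎
  where open ≡-Reasoning

rotate-≼ : ∀ {n} {s t : Word (suc n)} → s ≼ t → rotate s ≼ rotate t
rotate-≼ (a≤b ∷ v≼w) = ∷ʳ⁺ v≼w a≤b

rotate-≼⁻ : ∀ {n} (s t : Word (suc n)) → rotate s ≼ rotate t → s ≼ t
rotate-≼⁻ (a ∷ v) (b ∷ w) le = let v≼w , a≤b = ∷ʳ⁻ v w le in a≤b ∷ v≼w

rotate-injective : ∀ {n} {s t : Word (suc n)} → rotate s ≡ rotate t → s ≡ t
rotate-injective {s = a ∷ v} {b ∷ w} eq = let v≡w , a≡b = ∷ʳ-injective v w eq in cong₂ _∷_ a≡b v≡w

rotate-surjective : ∀ {n} (t : Word (suc n)) → ∃[ s ] rotate s ≡ t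
rotate-surjective t = let ys , y , t≡ys∷ʳy = initLast t in y ∷ ys , sym t≡ys∷ʳy

weight-rotate : ∀ {n} (t : Word (suc n)) → weight (rotate t) ≡ weight t
weight-rotate (a ∷ v) = weight-∷ʳ v
  where
    weight-∷ʳ : ∀ {n} (v : Word n) → weight (v ∷ʳ a) ≡ weight (a ∷ v)
    weight-∷ʳ [] = refl
    weight-∷ʳ (false ∷ v) = weight-∷ʳ v
    weight-∷ʳ (true ∷ v) = trans (cong suc (weight-∷ʳ v)) (weight-true a)
      where
        weight-true : ∀ a → suc (weight (a ∷ v)) ≡ weight (a ∷ true ∷ v)
        weight-true true = refl
        weight-true false = refl

IsMaximalLucas : ∀ {n} → Word n → Set
IsMaximalLucas t = Lucas t × (∀ t′ → t ≼ t′ → Lucas t′ → t′ ≡ t)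

maximal-rotate : ∀ {n} {t : Word (suc n)} → IsMaximalLucas t → IsMaximalLucas (rotate t)
maximal-rotate {t = t} (Lt , max) = subst T (sym (isLucas-rotate t)) Lt , above
  where
    above : ∀ s → rotate t ≼ s → Lucas s → s ≡ rotate t
    above s rt≼s Ls with rotate-surjective s
    ... | t′ , refl = cong rotate (max t′ (rotate-≼⁻ t t′ rt≼s) (subst T (isLucas-rotate t′) Ls))

maximal-rotate⁻ : ∀ {n} (t : Word (suc n)) → IsMaximalLucas (rotate t) → IsMaximalLucas t
maximal-rotate⁻ t (Lrt , max) = subst T (isLucas-rotate t) Lrt , λ t′ t≼t′ Lt′ →
  rotate-injective (max (rotate t′) (rotate-≼ t≼t′) (subst T (sym (isLucas-rotate t′)) Lt′))

-- Maximal hypercubes of Λ_n and maximal Lucas strings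

subcube-hypercube : ∀ {n p} (b m : Word n) → weight m ≡ p → Lucas (top b m) →
                    HypercubeΛ n p (subcube b m)
subcube-hypercube b m refl Ltop =
  (λ v v∈ → Lucas-antitone (InSubcube⇒≼top (∈-subcube⁻ b m v v∈)) Ltop) , subcube-induces b m

downset : ∀ {n} → Word n → VSet n
downset = subcube zeros

∈-downset⁺ : ∀ {n} (t v : Word n) → v ≼ t → v ∈V downset t
∈-downset⁺ t v = ∈-subcube⁺ ∘ InSubcube-zeros⁺

∈-downset⁻ : ∀ {n} (t v : Word n) → v ∈V downset t → v ≼ t
∈-downset⁻ t v = InSubcube-zeros⁻ ∘ ∈-subcube⁻ zeros t v

downset-injective : ∀ {n} {s t : Word n} → downset s ≡ downset t → s ≡ t
downset-injective {s = s} {t} eq = ≼-antisym (below eq) (below (sym eq))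
  where
    below : ∀ {s t} → downset s ≡ downset t → s ≼ t
    below {s} {t} eq = ∈-downset⁻ t s (subst (s ∈V_) eq (∈-downset⁺ s s ≼-refl))

maximal⇒MaxHypercube : ∀ {n p} {t : Word n} → IsMaximalLucas t → weight t ≡ p →
                       MaxHypercubeΛ n p (downset t)
maximal⇒MaxHypercube {n} {p} {t} (Lt , max) refl = hypercube , no-larger
  where
    hypercube : HypercubeΛ n p (downset t)
    hypercube = (λ v v∈ → Lucas-antitone (∈-downset⁻ t v v∈) Lt) , subcube-induces zeros t
    no-larger : ¬ (∃[ T ] (HypercubeΛ n (suc p) T × downset t ⊆V T))
    no-larger (T , (T⊆Λ , iq) , t↓⊆T) with induced-subcube iq
    ... | b , m , weight-m , T⇔ = 1+n≢n (trans (sym weight-m) (cong weight m≡t))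
      where
        in-T : ∀ v → v ≼ t → InSubcube b m v
        in-T v v≼t = Equivalence.to (T⇔ v) (t↓⊆T v (∈-downset⁺ t v v≼t))
        zeros∈ : InSubcube b m zeros
        zeros∈ = in-T zeros (zeros-≼ t)
        m∈T : m ∈V T
        m∈T = Equivalence.from (T⇔ m) (InSubcube-trans zeros∈ (InSubcube-zeros⁺ ≼-refl))
        t≼m : t ≼ m
        t≼m = InSubcube-zeros⁻ (InSubcube-trans (InSubcube-sym zeros∈) (in-T t ≼-refl))
        m≡t : m ≡ t
        m≡t = max m t≼m (T⊆Λ m m∈T)

MaxHypercube⇒maximal : ∀ {n p} {S : VSet n} → MaxHypercubeΛ n p S →
                       ∃[ t ] (IsMaximalLucas t × weight t ≡ p × S ≡ downset t)
MaxHypercube⇒maximal {n} {S = S} ((S⊆Λ , iq) , no-larger) with induced-subcube iq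
... | b , m , refl , S⇔ = m , (Lucas-m , above-m) , refl , S≡downset
  where
    to : ∀ v → v ∈V S → InSubcube b m v
    to v = Equivalence.to (S⇔ v)
    from : ∀ v → InSubcube b m v → v ∈V S
    from v = Equivalence.from (S⇔ v)
    Lucas-top : Lucas (top b m)
    Lucas-top = S⊆Λ (top b m) (from (top b m) (InSubcube-top b m))
    -- Otherwise m can be enlarged by one coordinate inside t, giving a larger hypercube in Λ_n.
    above-top : ∀ t → top b m ≼ t → Lucas t → t ≡ m
    above-top t top≼t Lt with ≡-dec _≟ᵇ_ m t
    ... | yes m≡t = sym m≡t
    ... | no m≢t with ≺-step (≼-trans (proj₂ (≼top b m)) top≼t) m≢t
    ...   | m′ , m≼m′ , m′≼t , weight-m′ = ⊥-elim (no-larger (subcube b m′ , hypercube , S⊆))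
      where
        hypercube : HypercubeΛ n (suc (weight m)) (subcube b m′)
        hypercube = subcube-hypercube b m′ weight-m′
                      (Lucas-antitone (top-least (≼-trans (proj₁ (≼top b m)) top≼t) m′≼t) Lt)
        S⊆ : S ⊆V subcube b m′
        S⊆ v v∈S = ∈-subcube⁺ (InSubcube-widen m≼m′ (to v v∈S))
    top≡m : top b m ≡ m
    top≡m = above-top (top b m) ≼-refl Lucas-top
    Lucas-m : Lucas m
    Lucas-m = subst Lucas top≡m Lucas-top
    above-m : ∀ t → m ≼ t → Lucas t → t ≡ m
    above-m t m≼t = above-top t (subst (_≼ t) (sym top≡m) m≼t)
    b∈downset : InSubcube zeros m b
    b∈downset = InSubcube-zeros⁺ (subst (b ≼_) top≡m (proj₁ (≼top b m)))
    S≡downset : S ≡ downset m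
    S≡downset = VSet-ext S (downset m)
      (λ v v∈S → ∈-subcube⁺ (InSubcube-trans b∈downset (to v v∈S)))
      (λ v v∈ → from v (InSubcube-trans (InSubcube-sym b∈downset) (∈-subcube⁻ zeros m v v∈)))

-- Block words

10++_ : ∀ {n} → Word n → Word (2 + n)
10++ w = true ∷ false ∷ w

100++_ : ∀ {n} → Word n → Word (3 + n)
100++ w = true ∷ false ∷ false ∷ w

data Blocks : ∀ {n} → Word n → ℕ → Set where
  [] : Blocks [] 0
  10∷_ : ∀ {n p} {w : Word n} → Blocks w p → Blocks (10++ w) (suc p)
  100∷_ : ∀ {n p} {w : Word n} → Blocks w p → Blocks (100++ w) (suc p)

Blocks-weight : ∀ {n p} {w : Word n} → Blocks w p → weight w ≡ p
Blocks-weight [] = refl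
Blocks-weight (10∷ d) = cong suc (Blocks-weight d)
Blocks-weight (100∷ d) = cong suc (Blocks-weight d)

head-Blocks : ∀ {n p} {s : Word (suc n)} → Blocks s (suc p) → head s ≡ true
head-Blocks (10∷ _) = refl
head-Blocks (100∷ _) = refl

head-rotate-Blocks : ∀ {n p} {s : Word (suc n)} → Blocks s (suc p) → head (rotate s) ≡ false
head-rotate-Blocks (10∷ _) = refl
head-rotate-Blocks (100∷ _) = refl

Blocks-noConsec : ∀ {n p} {w : Word n} → Blocks w p → T (noConsec (w ∷ʳ true))
Blocks-noConsec [] = tt
Blocks-noConsec (10∷_ {w = w} d) = noConsec-false∷ (w ∷ʳ true) (Blocks-noConsec d)
Blocks-noConsec (100∷_ {w = w} d) = noConsec-false∷ (w ∷ʳ true) (Blocks-noConsec d)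

-- The trailing 1 stands for the first letter of a cyclic Lucas word.
Blocks-no-larger : ∀ {n p} {w w′ : Word n} → Blocks w p → w ≼ w′ → T (noConsec (w′ ∷ʳ true)) →
                   w′ ≡ w
Blocks-no-larger [] [] _ = refl
Blocks-no-larger (10∷ d) (Bool.b≤b ∷ Bool.f≤t ∷ _) ()
Blocks-no-larger {w′ = _ ∷ _ ∷ u} (10∷ d) (Bool.b≤b ∷ Bool.b≤b ∷ w≼u) nc =
  cong 10++_ (Blocks-no-larger d w≼u (noConsec-tail false (u ∷ʳ true) nc))
Blocks-no-larger (100∷ d) (Bool.b≤b ∷ Bool.f≤t ∷ _) ()
Blocks-no-larger {w′ = _ ∷ _ ∷ _ ∷ u} (100∷ d) (Bool.b≤b ∷ Bool.b≤b ∷ Bool.b≤b ∷ w≼u) nc =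
  cong 100++_ (Blocks-no-larger d w≼u (noConsec-tail false (u ∷ʳ true) nc))
Blocks-no-larger (100∷ []) (Bool.b≤b ∷ Bool.b≤b ∷ Bool.f≤t ∷ []) ()
Blocks-no-larger (100∷ 10∷ d) (Bool.b≤b ∷ Bool.b≤b ∷ Bool.f≤t ∷ Bool.b≤b ∷ _) ()
Blocks-no-larger (100∷ 100∷ d) (Bool.b≤b ∷ Bool.b≤b ∷ Bool.f≤t ∷ Bool.b≤b ∷ _) ()

Blocks⇒maximal : ∀ {n p} {w : Word n} → Blocks w (suc p) → IsMaximalLucas w
Blocks⇒maximal {w = true ∷ v} d = subst T (sym (isLucas-cyclic true v)) (Blocks-noConsec d) , above
  where
    above : ∀ t′ → true ∷ v ≼ t′ → Lucas t′ → t′ ≡ true ∷ v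
    above (true ∷ v′) le Lt′ = Blocks-no-larger d le (subst T (isLucas-cyclic true v′) Lt′)
    above (false ∷ v′) (() ∷ _) _

blocks-or-extendable : ∀ {n} (v : Word n) → T (noConsec ((true ∷ v) ∷ʳ true)) →
  (∃[ p ] Blocks (true ∷ v) p) ⊎
  (∃[ v′ ] (v ≼ v′ × v′ ≢ v × T (noConsec ((true ∷ v′) ∷ʳ true))))
blocks-or-extendable [] ()
blocks-or-extendable (true ∷ v) ()
blocks-or-extendable (false ∷ []) _ = inj₁ (1 , 10∷ [])
blocks-or-extendable (false ∷ false ∷ []) _ = inj₁ (1 , 100∷ [])
blocks-or-extendable (false ∷ true ∷ v) nc with blocks-or-extendable v nc
... | inj₁ (p , d) = inj₁ (suc p , 10∷ d)
... | inj₂ (v′ , v≼v′ , v′≢v , nc′) =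
  inj₂ (false ∷ true ∷ v′ , Bool.b≤b ∷ Bool.b≤b ∷ v≼v′ , (λ { refl → v′≢v refl }) , nc′)
blocks-or-extendable (false ∷ false ∷ true ∷ v) nc with blocks-or-extendable v nc
... | inj₁ (p , d) = inj₁ (suc p , 100∷ d)
... | inj₂ (v′ , v≼v′ , v′≢v , nc′) =
  inj₂ (false ∷ false ∷ true ∷ v′ , Bool.b≤b ∷ Bool.b≤b ∷ Bool.b≤b ∷ v≼v′ ,
        (λ { refl → v′≢v refl }) , nc′)
blocks-or-extendable (false ∷ false ∷ false ∷ v) nc =
  inj₂ (false ∷ true ∷ false ∷ v , Bool.b≤b ∷ Bool.f≤t ∷ ≼-refl , (λ ()) , nc)

maximal⇒Blocks : ∀ {n p} {v : Word n} → IsMaximalLucas (true ∷ v) → weight (true ∷ v) ≡ p →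
                 Blocks (true ∷ v) p
maximal⇒Blocks {v = v} (L , max) refl with blocks-or-extendable v (subst T (isLucas-cyclic true v) L)
... | inj₁ (p , d) = subst (Blocks (true ∷ v)) (sym (Blocks-weight d)) d
... | inj₂ (v′ , v≼v′ , v′≢v , nc′) =
  contradiction (∷-injectiveʳ (max (true ∷ v′) (Bool.b≤b ∷ v≼v′) L′)) v′≢v
  where
    L′ : Lucas (true ∷ v′)
    L′ = subst T (sym (isLucas-cyclic true v′)) nc′

blocks : (n p : ℕ) → List (Word n)
blocks100 : (n p : ℕ) → List (Word (2 + n))

blocks zero zero = [ [] ]
blocks zero (suc p) = []
blocks (suc n) zero = []
blocks (suc zero) (suc p) = []
blocks (suc (suc n)) (suc p) = map 10++_ (blocks n p) ++ blocks100 n p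

blocks100 zero p = []
blocks100 (suc n) p = map 100++_ (blocks n p)

∈-blocks⁻ : ∀ {n p} {w : Word n} → w ∈ blocks n p → Blocks w p
∈-blocks100⁻ : ∀ {n p} {w : Word (2 + n)} → w ∈ blocks100 n p → Blocks w (suc p)

∈-blocks⁻ {zero} {zero} (here refl) = []
∈-blocks⁻ {suc (suc n)} {suc p} w∈ with ∈-++⁻ (map 10++_ (blocks n p)) w∈
... | inj₂ w∈100 = ∈-blocks100⁻ w∈100
... | inj₁ w∈10 with ∈-map⁻ 10++_ w∈10
...   | u , u∈ , refl = 10∷ ∈-blocks⁻ u∈

∈-blocks100⁻ {suc n} w∈ with ∈-map⁻ 100++_ w∈
... | u , u∈ , refl = 100∷ ∈-blocks⁻ u∈

∈-blocks⁺ : ∀ {n p} {w : Word n} → Blocks w p → w ∈ blocks n p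
∈-blocks⁺ [] = here refl
∈-blocks⁺ (10∷ d) = ∈-++⁺ˡ (∈-map⁺ 10++_ (∈-blocks⁺ d))
∈-blocks⁺ {suc (suc (suc n))} {suc p} (100∷ d) =
  ∈-++⁺ʳ (map 10++_ (blocks (suc n) p)) (∈-map⁺ 100++_ (∈-blocks⁺ d))

blocks-unique : ∀ n p → Unique (blocks n p)
blocks100-unique : ∀ n p → Unique (blocks100 n p)

blocks-unique zero zero = All.[] AllPairs.∷ AllPairs.[]
blocks-unique zero (suc p) = AllPairs.[]
blocks-unique (suc n) zero = AllPairs.[]
blocks-unique (suc zero) (suc p) = AllPairs.[]
blocks-unique (suc (suc n)) (suc p) =
  Unique.++⁺ (Unique.map⁺ (∷-injectiveʳ ∘ ∷-injectiveʳ) (blocks-unique n p))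
             (blocks100-unique n p) disjoint
  where
    disjoint : ∀ {n w} → ¬ (w ∈ map 10++_ (blocks n p) × w ∈ blocks100 n p)
    disjoint {zero} (_ , ())
    disjoint {suc n} (w∈10 , w∈100) with ∈-map⁻ 10++_ w∈10 | ∈-map⁻ 100++_ w∈100
    ... | u , u∈ , refl | _ , _ , refl with ∈-blocks⁻ {p = p} u∈
    ...   | ()

blocks100-unique zero p = AllPairs.[]
blocks100-unique (suc n) p =
  Unique.map⁺ (∷-injectiveʳ ∘ ∷-injectiveʳ ∘ ∷-injectiveʳ) (blocks-unique n p)

-- Enumeration of the maximal Lucas strings

rotations : (n q : ℕ) → List (Word (2 + n))
rotations n q = map rotate (blocks (2 + n) (suc q)) ++ map (rotate ∘ rotate) (blocks100 n q)

maximalWords : (n p : ℕ) → List (Word n)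
maximalWords (suc (suc n)) (suc q) = blocks (2 + n) (suc q) ++ rotations n q
maximalWords _ _ = []

maximal-rotate-weight : ∀ {n p} {t : Word (suc n)} → IsMaximalLucas t × weight t ≡ p →
                        IsMaximalLucas (rotate t) × weight (rotate t) ≡ p
maximal-rotate-weight {t = t} (max , w) = maximal-rotate max , trans (weight-rotate t) w

Blocks⇒maximal-weight : ∀ {n p} {w : Word n} → Blocks w (suc p) → IsMaximalLucas w × weight w ≡ suc p
Blocks⇒maximal-weight d = Blocks⇒maximal d , Blocks-weight d

∈-maximalWords⁻ : ∀ {n p} {t : Word n} → t ∈ maximalWords n p → IsMaximalLucas t × weight t ≡ p
∈-maximalWords⁻ {suc (suc n)} {suc q} t∈ with ∈-++⁻ (blocks (2 + n) (suc q)) t∈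
... | inj₁ t∈blocks = Blocks⇒maximal-weight (∈-blocks⁻ t∈blocks)
... | inj₂ t∈rotations with ∈-++⁻ (map rotate (blocks (2 + n) (suc q))) t∈rotations
...   | inj₁ t∈rotate with ∈-map⁻ rotate t∈rotate
...     | s , s∈ , refl = maximal-rotate-weight (Blocks⇒maximal-weight (∈-blocks⁻ s∈))
∈-maximalWords⁻ {suc (suc n)} {suc q} t∈ | inj₂ _ | inj₂ t∈rotate²
  with ∈-map⁻ (rotate ∘ rotate) t∈rotate²
...     | s , s∈ , refl =
  maximal-rotate-weight (maximal-rotate-weight (Blocks⇒maximal-weight (∈-blocks100⁻ s∈)))

-- A maximal word starting with 0 ends in 1 (a rotation of a block word), or in 10 (a double rotation
-- of a block word starting with 100); ending in 00 would leave room for another 1.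
∈-maximalWords⁺ : ∀ {n q} {t : Word n} → IsMaximalLucas t → weight t ≡ suc q →
                  t ∈ maximalWords n (suc q)
∈-maximalWords⁺ {t = []} _ ()
∈-maximalWords⁺ {t = false ∷ []} _ ()
∈-maximalWords⁺ {t = true ∷ []} (() , _) _
∈-maximalWords⁺ {suc (suc n)} {t = true ∷ v} max w = ∈-++⁺ˡ (∈-blocks⁺ (maximal⇒Blocks max w))
∈-maximalWords⁺ {suc (suc n)} {q} {t = false ∷ v} max w with initLast v
... | ys , true , refl = ∈-++⁺ʳ (blocks (2 + n) (suc q)) (∈-++⁺ˡ (∈-map⁺ rotate (∈-blocks⁺ d)))
  where
    s : Word (2 + n)
    s = 10++ ys
    d : Blocks s (suc q)
    d = maximal⇒Blocks (maximal-rotate⁻ s max) (trans (sym (weight-rotate s)) w)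
∈-maximalWords⁺ {suc (suc zero)} {t = false ∷ v} max () | [] , false , refl
∈-maximalWords⁺ {suc (suc (suc n))} {q} {t = false ∷ v} max w | ys , false , refl with initLast ys
... | zs , true , refl with maximal⇒Blocks (maximal-rotate⁻ s (maximal-rotate⁻ (rotate s) max)) weight-s
  where
    s : Word (3 + n)
    s = 100++ zs
    weight-s : weight s ≡ suc q
    weight-s = trans (sym (weight-rotate s)) (trans (sym (weight-rotate (rotate s))) w)
...   | 10∷ ()
...   | 100∷ d = ∈-++⁺ʳ (blocks (3 + n) (suc q)) (∈-++⁺ʳ (map rotate (blocks (3 + n) (suc q)))
                   (∈-map⁺ (rotate ∘ rotate) (∈-map⁺ 100++_ (∈-blocks⁺ d))))
∈-maximalWords⁺ {suc (suc (suc n))} {t = false ∷ v} max w | ys , false , refl | zs , false , refl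
  with maximal-rotate⁻ s (maximal-rotate⁻ (rotate s) max)
  where
    s : Word (3 + n)
    s = false ∷ false ∷ false ∷ zs
... | Ls , above with above (false ∷ true ∷ false ∷ zs) (Bool.b≤b ∷ Bool.f≤t ∷ ≼-refl) Ls
...   | ()

rotations-head≡false : ∀ {n q t} → t ∈ rotations n q → head t ≡ false
rotations-head≡false {n} {q} t∈ with ∈-++⁻ (map rotate (blocks (2 + n) (suc q))) t∈
... | inj₁ t∈rotate with ∈-map⁻ rotate t∈rotate
...   | s , s∈ , refl = head-rotate-Blocks (∈-blocks⁻ s∈)
rotations-head≡false {suc n} t∈ | inj₂ t∈rotate² with ∈-map⁻ (rotate ∘ rotate) t∈rotate²
... | s , s∈ , refl with ∈-map⁻ 100++_ s∈
...   | _ , _ , refl = refl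

-- Rotations of block words end in 1, double rotations of words 100w end in 0.
rotations-disjoint : ∀ {n q t} →
  ¬ (t ∈ map rotate (blocks (2 + n) (suc q)) × t ∈ map (rotate ∘ rotate) (blocks100 n q))
rotations-disjoint {suc n} (t∈rotate , t∈rotate²)
  with ∈-map⁻ rotate t∈rotate | ∈-map⁻ (rotate ∘ rotate) t∈rotate²
... | s , s∈ , refl | s′ , s′∈ , eq with ∈-map⁻ 100++_ s′∈ | ∈-blocks⁻ s∈
...   | u , _ , refl | 10∷_ {w = w} _ =
  contradiction (∷ʳ-injectiveʳ (false ∷ w) (false ∷ (u ∷ʳ true)) eq) λ ()
...   | u , _ , refl | 100∷_ {w = w} _ =
  contradiction (∷ʳ-injectiveʳ (false ∷ false ∷ w) (false ∷ (u ∷ʳ true)) eq) λ ()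

maximalWords-unique : ∀ n p → Unique (maximalWords n p)
maximalWords-unique zero p = AllPairs.[]
maximalWords-unique (suc zero) p = AllPairs.[]
maximalWords-unique (suc (suc n)) zero = AllPairs.[]
maximalWords-unique (suc (suc n)) (suc q) =
  Unique.++⁺ (blocks-unique (2 + n) (suc q))
    (Unique.++⁺ (Unique.map⁺ rotate-injective (blocks-unique (2 + n) (suc q)))
                (Unique.map⁺ (rotate-injective ∘ rotate-injective) (blocks100-unique n q))
                rotations-disjoint)
    (λ (t∈blocks , t∈rotations) →
      contradiction (trans (sym (head-Blocks (∈-blocks⁻ t∈blocks))) (rotations-head≡false t∈rotations)) λ ())

-- Counting

absorption : ∀ n k → suc k * (suc n C suc k) ≡ suc n * (n C k)
absorption zero zero = refl
absorption zero (suc k) = begin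
  suc (suc k) * (1 C suc (suc k)) ≡⟨ cong (suc (suc k) *_) (k>n⇒nCk≡0 {1} {suc (suc k)} (s≤s (s≤s z≤n))) ⟩
  suc (suc k) * 0                 ≡⟨ *-zeroʳ (suc (suc k)) ⟩
  0                               ≡⟨ cong (1 *_) (k>n⇒nCk≡0 {0} {suc k} (s≤s z≤n)) ⟨
  1 * (0 C suc k)                 ∎
  where open ≡-Reasoning
absorption (suc n) zero =
  trans (+-identityʳ (suc (suc n) C 1)) (trans (nC1≡n (suc (suc n))) (sym (*-identityʳ (suc (suc n)))))
absorption (suc n) (suc k) = begin
  suc (suc k) * (suc (suc n) C suc (suc k)) ≡⟨ cong (suc (suc k) *_) (pascal (suc n) (suc k)) ⟨
  suc (suc k) * (a + b)                     ≡⟨ expand k a b ⟩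
  a + suc k * a + suc (suc k) * b           ≡⟨ cong₂ (λ x y → a + x + y) (absorption n k) (absorption n (suc k)) ⟩
  a + suc n * c + suc n * d                 ≡⟨ cong (λ x → x + suc n * c + suc n * d) (pascal n k) ⟨
  c + d + suc n * c + suc n * d             ≡⟨ collect n c d ⟩
  suc (suc n) * (c + d)                     ≡⟨ cong (suc (suc n) *_) (pascal n k) ⟩
  suc (suc n) * (suc n C suc k)             ∎
  where
    open ≡-Reasoning
    pascal : ∀ n k → n C k + n C suc k ≡ suc n C suc k
    pascal = nCk+nC[k+1]≡[n+1]C[k+1]
    a b c d : ℕ
    a = suc n C suc k
    b = suc n C suc (suc k)
    c = n C k
    d = n C suc k
    expand : ∀ k a b → suc (suc k) * (a + b) ≡ a + suc k * a + suc (suc k) * b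
    expand = solve-∀
    collect : ∀ n c d → c + d + suc n * c + suc n * d ≡ suc (suc n) * (c + d)
    collect = solve-∀

blocks-short : ∀ {n p} → n < p + p → blocks n p ≡ []
blocks100-short : ∀ {n p} → n ≤ p + p → blocks100 n p ≡ []

blocks-short {zero} {suc p} _ = refl
blocks-short {suc zero} {suc p} _ = refl
blocks-short {suc (suc n)} {suc p} (s≤s 2+n≤p+1+p) =
  cong₂ _++_ (cong (map 10++_) (blocks-short n<p+p)) (blocks100-short (<⇒≤ n<p+p))
  where
    n<p+p : n < p + p
    n<p+p = ≤-pred (subst (suc (suc n) ≤_) (+-suc p p) 2+n≤p+1+p)

blocks100-short {zero} _ = refl
blocks100-short {suc n} n<p+p = cong (map 100++_) (blocks-short n<p+p)

length-blocks-step : ∀ n p → length (blocks (2 + n) (suc p)) ≡ length (blocks n p) + length (blocks100 n p)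
length-blocks-step n p =
  trans (length-++ (map 10++_ (blocks n p))) (cong (_+ length (blocks100 n p)) (length-map 10++_ (blocks n p)))

[1+p]+[1+p]+k≡2+[p+p+k] : ∀ p k → suc p + suc p + k ≡ 2 + (p + p + k)
[1+p]+[1+p]+k≡2+[p+p+k] p k = cong (λ m → suc (m + k)) (+-suc p p)

length-blocks : ∀ p k → length (blocks (p + p + k) p) ≡ p C k
length-blocks-suc : ∀ p k → length (blocks (2 + (p + p + k)) (suc p)) ≡ suc p C k
length-blocks100 : ∀ p k → length (blocks100 (p + p + suc k) p) ≡ p C k

length-blocks zero zero = refl
length-blocks zero (suc k) = sym (k>n⇒nCk≡0 {0} {suc k} (s≤s z≤n))
length-blocks (suc p) k =
  trans (cong (λ n → length (blocks n (suc p))) ([1+p]+[1+p]+k≡2+[p+p+k] p k)) (length-blocks-suc p k)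

length-blocks-suc p zero = trans (length-blocks-step (p + p + 0) p)
  (cong₂ _+_ (length-blocks p 0) (cong length (blocks100-short (≤-reflexive (+-identityʳ (p + p))))))
length-blocks-suc p (suc k) = begin
  length (blocks (2 + (p + p + suc k)) (suc p))
    ≡⟨ length-blocks-step (p + p + suc k) p ⟩
  length (blocks (p + p + suc k) p) + length (blocks100 (p + p + suc k) p)
    ≡⟨ cong₂ _+_ (length-blocks p (suc k)) (length-blocks100 p k) ⟩
  p C suc k + p C k
    ≡⟨ +-comm (p C suc k) (p C k) ⟩
  p C k + p C suc k
    ≡⟨ nCk+nC[k+1]≡[n+1]C[k+1] p k ⟩
  suc p C suc k ∎
  where open ≡-Reasoning

length-blocks100 p k = begin
  length (blocks100 (p + p + suc k) p)   ≡⟨ cong (λ n → length (blocks100 n p)) (+-suc (p + p) k) ⟩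
  length (blocks100 (suc (p + p + k)) p) ≡⟨ length-map 100++_ (blocks (p + p + k) p) ⟩
  length (blocks (p + p + k) p)          ≡⟨ length-blocks p k ⟩
  p C k                                  ∎
  where open ≡-Reasoning

binomLucas-short : ∀ {n p} → n < p + p → binomLucas n p ≡ 0
binomLucas-short {n} {p} n<p+p with (p + p) ≤ᵇ n in eq
... | false = refl
... | true = contradiction (≤ᵇ⇒≤ (p + p) n (subst T (sym eq) tt)) (<⇒≱ n<p+p)

binomLucas-+ : ∀ p k → binomLucas (p + p + k) p ≡ p C k
binomLucas-+ p k with (p + p) ≤ᵇ (p + p + k) in eq
... | true = cong (p C_) (m+n∸m≡n (p + p) k)
... | false = ⊥-elim (subst T eq (≤⇒≤ᵇ (m≤m+n (p + p) k)))

maximalWords-short : ∀ {n q} → n < suc q + suc q → maximalWords n (suc q) ≡ []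
maximalWords-short {zero} _ = refl
maximalWords-short {suc zero} _ = refl
maximalWords-short {suc (suc n)} {q} n<2p = cong₂ _++_ blocks≡[]
  (cong₂ _++_ (cong (map rotate) blocks≡[]) (cong (map (rotate ∘ rotate)) (blocks100-short (<⇒≤ n<q+q))))
  where
    blocks≡[] : blocks (2 + n) (suc q) ≡ []
    blocks≡[] = blocks-short n<2p
    n<q+q : n < q + q
    n<q+q = ≤-pred (subst (suc (suc n) ≤_) (+-suc q q) (≤-pred n<2p))

length-maximalWords : ∀ n q → length (maximalWords (2 + n) (suc q)) ≡
                      length (blocks (2 + n) (suc q)) + (length (blocks (2 + n) (suc q)) + length (blocks100 n q))
length-maximalWords n q = begin
  length (bs ++ map rotate bs ++ map (rotate ∘ rotate) cs)
    ≡⟨ length-++ bs ⟩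
  length bs + length (map rotate bs ++ map (rotate ∘ rotate) cs)
    ≡⟨ cong (length bs +_) (length-++ (map rotate bs)) ⟩
  length bs + (length (map rotate bs) + length (map (rotate ∘ rotate) cs))
    ≡⟨ cong₂ (λ x y → length bs + (x + y)) (length-map rotate bs) (length-map (rotate ∘ rotate) cs) ⟩
  length bs + (length bs + length cs) ∎
  where
    open ≡-Reasoning
    bs : List (Word (2 + n))
    bs = blocks (2 + n) (suc q)
    cs : List (Word (2 + n))
    cs = blocks100 n q

count-maximalWords-2p+k : ∀ q k → suc q * length (maximalWords (2 + (q + q + k)) (suc q)) ≡
                                  (2 + (q + q + k)) * (suc q C k)
count-maximalWords-2p+k q zero = begin
  suc q * length (maximalWords (2 + (q + q + 0)) (suc q))
    ≡⟨ cong (suc q *_) (length-maximalWords (q + q + 0) q) ⟩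
  suc q * (B + (B + length (blocks100 (q + q + 0) q)))
    ≡⟨ cong₂ (λ x y → suc q * (x + (x + y))) (length-blocks-suc q 0) (cong length no-100-block) ⟩
  suc q * 2
    ≡⟨ double q ⟩
  (2 + (q + q + 0)) * 1 ∎
  where
    open ≡-Reasoning
    B : ℕ
    B = length (blocks (2 + (q + q + 0)) (suc q))
    no-100-block : blocks100 (q + q + 0) q ≡ []
    no-100-block = blocks100-short (≤-reflexive (+-identityʳ (q + q)))
    double : ∀ q → suc q * 2 ≡ (2 + (q + q + 0)) * 1
    double = solve-∀
count-maximalWords-2p+k q (suc k) = begin
  suc q * length (maximalWords (2 + (q + q + suc k)) (suc q))
    ≡⟨ cong (suc q *_) (length-maximalWords (q + q + suc k) q) ⟩
  suc q * (B′ + (B′ + length (blocks100 (q + q + suc k) q)))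
    ≡⟨ cong₂ (λ x y → suc q * (x + (x + y))) (length-blocks-suc q (suc k)) (length-blocks100 q k) ⟩
  suc q * (B + (B + R))
    ≡⟨ distribute q B R ⟩
  (suc q + suc q) * B + suc q * R
    ≡⟨ cong ((suc q + suc q) * B +_) (absorption q k) ⟨
  (suc q + suc q) * B + suc k * B
    ≡⟨ collect q k B ⟩
  (2 + (q + q + suc k)) * B ∎
  where
    open ≡-Reasoning
    B′ B R : ℕ
    B′ = length (blocks (2 + (q + q + suc k)) (suc q))
    B = suc q C suc k
    R = q C k
    distribute : ∀ q B R → suc q * (B + (B + R)) ≡ (suc q + suc q) * B + suc q * R
    distribute = solve-∀
    collect : ∀ q k B → (suc q + suc q) * B + suc k * B ≡ (2 + (q + q + suc k)) * B
    collect = solve-∀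

count-maximalWords : ∀ n q → suc q * length (maximalWords n (suc q)) ≡ n * binomLucas n (suc q)
count-maximalWords n q with n <? suc q + suc q
... | yes n<2p = begin
  suc q * length (maximalWords n (suc q)) ≡⟨ cong (λ L → suc q * length L) (maximalWords-short n<2p) ⟩
  suc q * 0                               ≡⟨ *-zeroʳ (suc q) ⟩
  0                                       ≡⟨ *-zeroʳ n ⟨
  n * 0                                   ≡⟨ cong (n *_) (binomLucas-short {n} {suc q} n<2p) ⟨
  n * binomLucas n (suc q)                ∎
  where open ≡-Reasoning
... | no n≮2p with m≤n⇒∃[o]m+o≡n (≮⇒≥ n≮2p)
...   | k , refl = begin
  suc q * length (maximalWords (suc q + suc q + k) (suc q))
    ≡⟨ cong (λ n → suc q * length (maximalWords n (suc q))) ([1+p]+[1+p]+k≡2+[p+p+k] q k) ⟩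
  suc q * length (maximalWords (2 + (q + q + k)) (suc q))
    ≡⟨ count-maximalWords-2p+k q k ⟩
  (2 + (q + q + k)) * (suc q C k)
    ≡⟨ cong₂ _*_ ([1+p]+[1+p]+k≡2+[p+p+k] q k) (binomLucas-+ (suc q) k) ⟨
  (suc q + suc q + k) * binomLucas (suc q + suc q + k) (suc q) ∎
  where open ≡-Reasoning

theorem2 : (n p : ℕ) → 1 ≤ p → p ≤ n →
    ∃[ L ] (Unique L × (∀ (S : VSet n) → (S ∈ L) ⇔ MaxHypercubeΛ n p S)
    × p * length L ≡ n * binomLucas n p)
theorem2 n (suc q) _ _ =
  map downset (maximalWords n (suc q)) ,
  Unique.map⁺ downset-injective (maximalWords-unique n (suc q)) ,
  (λ S → mk⇔ (sound S) (complete S)) ,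
  trans (cong (suc q *_) (length-map downset (maximalWords n (suc q)))) (count-maximalWords n q)
  where
    sound : ∀ S → S ∈ map downset (maximalWords n (suc q)) → MaxHypercubeΛ n (suc q) S
    sound S S∈ with ∈-map⁻ downset S∈
    ... | t , t∈ , refl = let t-max , weight-t = ∈-maximalWords⁻ t∈ in maximal⇒MaxHypercube t-max weight-t
    complete : ∀ S → MaxHypercubeΛ n (suc q) S → S ∈ map downset (maximalWords n (suc q))
    complete S S-max with MaxHypercube⇒maximal S-max
    ... | t , t-max , weight-t , refl = ∈-map⁺ downset (∈-maximalWords⁺ t-max weight-t)
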